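{- Let $b\in F(s)$ and let $b^*\in\dot F(s)$ be its dual. Then $b$ is a tableau if and only if $b^*$ is Yamanouchi, and $b$ is Yamanouchi if and only if $b^*$ is an antitableau.
   Context: Fix integers $n,\ell\ge 2$ and $s\ge 0$. A column with entries in $\{1,\dots,m\}$ is a subset of $\{1,\dots,m\}$, viewed as a strictly increasing one-column filling. $F(s)$ is the set of formal tensor products $b=c_\ell\otimes\cdots\otimes c_1$ of $\ell$ columns with entries in $\{1,\dots,n\}$ with $\sum_j|c_j|=s$; $\dot F(s)$ is the set of $d_1\otimes\cdots\otimes d_n$ of $n$ columns with entries in $\{1,\dots,\ell\}$ with $\sum_i|d_i|=s$. The duality $b\mapsto b^*$ sends $b=c_\ell\otimes\cdots\otimes c_1$ to $b^*=d(1)\otimes\cdots\otimes d(n)$ where $d(i)=\{j\in\{1,\dots,\ell\}: i\in c_j\}$. The word of $c_\ell\otimes\cdots\otimes c_1$ is the concatenation of the entries of $c_\ell$ (in increasing order), then of $c_{\ell-1}$, ..., then of $c_1$; the word of $d_1\otimes\cdots\otimes d_n$ is the concatenation of the entries of $d_1$, then $d_2$, ..., then $d_n$. An element is Yamanouchi if every prefix of its word contains at least as many letters $k$ as letters $k+1$, for every $k$. An element $c_\ell\otimes\cdots\otimes c_1\in F(s)$ is a tableau if placing the columns $c_1,c_2,\dots,c_\ell$ from left to right, top-aligned, gives a semistandard Young tableau (column lengths weakly decreasing, rows weakly increasing, columns strictly increasing); it is an antitableau if placing $c_1,\dots,c_\ell$ from left to right, bottom-aligned, gives a semistandard skew Young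 tableau (column lengths weakly increasing, rows weakly increasing). For $d_1\otimes\cdots\otimes d_n\in\dot F(s)$ the notions of tableau and antitableau are defined in the same way, with the columns placed in the order $d_n,d_{n-1},\dots,d_1$ from left to right. -}

module Defs where

open import Data.Nat using (ℕ; zero; suc; _≤_)
open import Data.Nat.Properties using (_≟_)
open import Data.Fin using (Fin; zero; suc; toℕ)
import Data.Fin as Fin
open import Data.Fin.Subset using (Subset; ∣_∣)
open import Data.Vec using (Vec; []; _∷_; lookup) renaming (tabulate to vtabulate)
open import Data.Bool using (true; false)
open import Data.List using (List; []; _∷_; map; reverse; concat; length; filter; take; tabulate)
open import Data.Nat.ListAction using (sum)
open import Data.List.Relation.Unary.Linked using (Linked)

-- Entries {1,…,m} are modelled by Fin m (value i+1 ↦ i).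
-- A column with entries in {1,…,m} is a subset of Fin m (Subset m).
-- An element c_ℓ ⊗ ⋯ ⊗ c_1 of F(s) is a function c : Fin ℓ → Subset n with
--   c j = c_{j+1}.
-- An element d_1 ⊗ ⋯ ⊗ d_n of Ḟ(s) is a function d : Fin n → Subset ℓ with
--   d i = d_{i+1}.

entries : ∀ {m} → Subset m → List (Fin m)
entries {zero} [] = []
entries {suc m} (true ∷ c) = zero ∷ map suc (entries c)
entries {suc m} (false ∷ c) = map suc (entries c)

size : ∀ {m k} → (Fin k → Subset m) → ℕ
size {k = k} c = sum (tabulate (λ j → ∣ c j ∣))

dual : ∀ {n ℓ} → (Fin ℓ → Subset n) → (Fin n → Subset ℓ)
dual c i = vtabulate (λ j → lookup (c j) i)

count : ∀ {m} → ℕ → List (Fin m) → ℕ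
count k w = length (filter (λ x → toℕ x ≟ k) w)

YamanouchiWord : ∀ {m} → List (Fin m) → Set
YamanouchiWord w = ∀ (i k : ℕ) → count (suc k) (take i w) ≤ count k (take i w)

-- pointwise weak increase along the rows of two top-aligned columns
-- (compared on the common length)
data RowLe {m : ℕ} : List (Fin m) → List (Fin m) → Set where
  []ˡ : ∀ {ys} → RowLe [] ys
  []ʳ : ∀ {x xs} → RowLe (x ∷ xs) []
  _∷_ : ∀ {x y xs ys} → x Fin.≤ y → RowLe xs ys → RowLe (x ∷ xs) (y ∷ ys)

-- left column x, right column y, top-aligned: lengths weakly decreasing,
-- rows weakly increasing
TopAdj : ∀ {m} → Subset m → Subset m → Set
TopAdj x y = (length (entries y) ≤ length (entries x)) × RowLe (entries x) (entries y)
  where open import Data.Product using (_×_)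

-- left column x, right column y, bottom-aligned: lengths weakly increasing,
-- rows weakly increasing (rows compared from the bottom)
BotAdj : ∀ {m} → Subset m → Subset m → Set
BotAdj x y = (length (entries x) ≤ length (entries y))
           × RowLe (reverse (entries x)) (reverse (entries y))
  where open import Data.Product using (_×_)

-- c_1, …, c_ℓ (left-to-right order of the columns)
colsF : ∀ {n ℓ} → (Fin ℓ → Subset n) → List (Subset n)
colsF c = tabulate c

wordF : ∀ {n ℓ} → (Fin ℓ → Subset n) → List (Fin n)
wordF c = concat (map entries (reverse (colsF c)))

YamanouchiF : ∀ {n ℓ} → (Fin ℓ → Subset n) → Set
YamanouchiF c = YamanouchiWord (wordF c)

TableauF : ∀ {n ℓ} → (Fin ℓ → Subset n) → Set
TableauF c = Linked TopAdj (colsF c)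

AntitableauF : ∀ {n ℓ} → (Fin ℓ → Subset n) → Set
AntitableauF c = Linked BotAdj (colsF c)

wordḞ : ∀ {n ℓ} → (Fin n → Subset ℓ) → List (Fin ℓ)
wordḞ d = concat (map entries (tabulate d))

YamanouchiḞ : ∀ {n ℓ} → (Fin n → Subset ℓ) → Set
YamanouchiḞ d = YamanouchiWord (wordḞ d)

-- columns placed left to right in the order d_n, …, d_1
colsḞ : ∀ {n ℓ} → (Fin n → Subset ℓ) → List (Subset ℓ)
colsḞ d = reverse (tabulate d)

TableauḞ : ∀ {n ℓ} → (Fin n → Subset ℓ) → Set
TableauḞ d = Linked TopAdj (colsḞ d)

AntitableauḞ : ∀ {n ℓ} → (Fin n → Subset ℓ) → Set
AntitableauḞ d = Linked BotAdj (colsḞ d)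

module Submission where

-- Read a column as its 0/1 membership vector.  Among the first j columns d(1), …, d(j) of the word
-- of b*, the letter k occurs once for each i ≤ j with i ∈ c_k, i.e. as often as c_k has entries ≤ j.
-- The columns of b* are increasing, so its word is Yamanouchi as soon as the ballot condition holds
-- at the column boundaries.  Hence b* is Yamanouchi iff, for all j and k, c_{k+1} has at most as many
-- entries ≤ j as c_k; for increasing columns this says precisely that c_{k+1} fits to the right of
-- c_k, top-aligned, in a semistandard tableau.  Dually, the first j columns c_ℓ, …, c_{ℓ-j+1} of the
-- word of b contain the letter k as often as d(k) has entries > ℓ - j, and comparing these suffix
-- counts of d(k+1) and d(k) is the bottom-aligned condition for d(k+1) to the left of d(k).

open import Defs
open import Data.Nat using (ℕ; _≤_)
open import Data.Fin using (Fin)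
open import Data.Fin.Subset using (Subset)
open import Data.Product using (_×_)
open import Function.Bundles using (_⇔_)
open import Relation.Binary.PropositionalEquality using (_≡_)

open import Level using (0ℓ)
open import Function using (_∘_; flip)
open import Function.Bundles using (mk⇔; Equivalence)
import Function.Properties.Equivalence as ⇔
open import Data.Product using (_,_; proj₁; proj₂; uncurry)
open import Data.Product.Function.NonDependent.Propositional using (_×-⇔_)
open import Data.Sum using (_⊎_; inj₁; inj₂)
open import Data.Bool using (Bool; true; false)
open import Data.Nat using (zero; suc; _+_; _∸_; _<_; z≤n; s≤s; s≤s⁻¹)
open import Data.Nat.Properties
  using (_<?_; _≤?_; _≟_; ≤-refl; ≤-trans; <-trans; <-irrefl; ≤-<-trans; <⇒≤; ≰⇒>; ≮⇒≥; ≤⇒≯; <⇒≱;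
         m≤n⇒m≤1+n; n≤1+n; m≤m+n; +-identityʳ; suc-injective; m∸[m∸n]≡n; m≤n⇒m∸n≡0; +-∸-assoc;
         module ≤-Reasoning)
open import Data.Fin using (toℕ; zero; suc)
import Data.Fin as Fin
import Data.Fin.Properties as Fin
open import Data.Vec using (Vec; []; _∷_; lookup; tail; toList)
open import Data.Vec.Properties using (lookup∘tabulate)
open import Data.List
  using (List; []; _∷_; [_]; _++_; map; filter; length; concat; take; drop; reverse; reverseAcc; tabulate)
open import Data.List.Properties
  using (length-++; length-map; length-tabulate; filter-++; filter-accept; filter-reject; filter-none; filter-all;
         filter-≐; take-map; map-tabulate; take-all; take-[]; drop-[]; take++drop≡id; concat-++;
         ++-assoc; ++-identityʳ; tabulate-cong; reverse-map; reverse-involutive; unfold-reverse;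
         length-reverse)
open import Data.List.Relation.Unary.All using (All; []; _∷_; universal)
import Data.List.Relation.Unary.All as All
import Data.List.Relation.Unary.All.Properties as All
open import Data.List.Relation.Unary.AllPairs using (AllPairs; []; _∷_)
import Data.List.Relation.Unary.AllPairs as AllPairs
import Data.List.Relation.Unary.AllPairs.Properties as AllPairs
open import Data.List.Relation.Unary.Linked using (Linked; []; [-]; _∷_)
import Data.List.Relation.Unary.Linked as Linked
open import Data.List.Relation.Unary.Linked.Properties using (AllPairs⇒Linked; Linked⇒AllPairs)
open import Data.List.Relation.Binary.Permutation.Propositional.Properties
  using (↭-reverse; ↭-length; filter-↭)
open import Data.Nat.ListAction using (sum)
open import Data.Nat.ListAction.Properties using (sum-↭)
open import Relation.Binary.Core using (Rel)
open import Relation.Binary.PropositionalEquality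
  using (refl; sym; trans; cong; cong₂; subst; subst₂; module ≡-Reasoning)
open import Relation.Nullary using (¬_; yes; no; contradiction)
open import Relation.Unary using (Pred; Decidable; ∁)

take-++ˡ : ∀ {A : Set} {n} (xs ys : List A) → n ≤ length xs → take n (xs ++ ys) ≡ take n xs
take-++ˡ {n = zero}  xs       ys _         = refl
take-++ˡ {n = suc n} (x ∷ xs) ys (s≤s n≤∣xs∣) = cong (x ∷_) (take-++ˡ xs ys n≤∣xs∣)

take-++ʳ : ∀ {A : Set} {n} (xs ys : List A) → length xs ≤ n →
           take n (xs ++ ys) ≡ xs ++ take (n ∸ length xs) ys
take-++ʳ             []       ys _          = refl
take-++ʳ {n = suc n} (x ∷ xs) ys (s≤s ∣xs∣≤n) = cong (x ∷_) (take-++ʳ xs ys ∣xs∣≤n)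

take-length-++ : ∀ {A : Set} (xs ys : List A) → take (length xs) (xs ++ ys) ≡ xs
take-length-++ xs ys = trans (take-++ˡ xs ys ≤-refl) (take-all (length xs) xs ≤-refl)

sum-zero : ∀ {xs} → All (_≡ 0) xs → sum xs ≡ 0
sum-zero []           = refl
sum-zero (refl ∷ xs≡0) = sum-zero xs≡0

sum-reverse : ∀ xs → sum (reverse xs) ≡ sum xs
sum-reverse xs = sum-↭ (↭-reverse xs)

sum-take-reverse : ∀ j xs → sum (take j (reverse xs)) ≡ sum (drop (length xs ∸ j) xs)
sum-take-reverse j [] = trans (cong sum (take-[] j)) (sym (cong sum (drop-[] (0 ∸ j))))
sum-take-reverse j (x ∷ xs) with j ≤? length xs
... | yes j≤∣xs∣ = begin
  sum (take j (reverse (x ∷ xs)))            ≡⟨ cong (sum ∘ take j) (unfold-reverse x xs) ⟩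
  sum (take j (reverse xs ++ [ x ]))         ≡⟨ cong sum (take-++ˡ (reverse xs) [ x ] j≤∣rev∣) ⟩
  sum (take j (reverse xs))                  ≡⟨ sum-take-reverse j xs ⟩
  sum (drop (length xs ∸ j) xs)              ≡⟨ cong (λ d → sum (drop d (x ∷ xs))) (+-∸-assoc 1 j≤∣xs∣) ⟨
  sum (drop (length (x ∷ xs) ∸ j) (x ∷ xs))  ∎
  where
  open ≡-Reasoning
  j≤∣rev∣ : j ≤ length (reverse xs)
  j≤∣rev∣ = subst (j ≤_) (sym (length-reverse xs)) j≤∣xs∣
... | no j≰∣xs∣ = begin
  sum (take j (reverse (x ∷ xs)))            ≡⟨ cong sum (take-all j _ ∣rev∣≤j) ⟩
  sum (reverse (x ∷ xs))                     ≡⟨ sum-reverse (x ∷ xs) ⟩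
  sum (x ∷ xs)                               ≡⟨ cong (λ d → sum (drop d (x ∷ xs))) (m≤n⇒m∸n≡0 (≰⇒> j≰∣xs∣)) ⟨
  sum (drop (length (x ∷ xs) ∸ j) (x ∷ xs))  ∎
  where
  open ≡-Reasoning
  ∣rev∣≤j : length (reverse (x ∷ xs)) ≤ j
  ∣rev∣≤j = subst (_≤ j) (sym (length-reverse (x ∷ xs))) (≰⇒> j≰∣xs∣)

∀-cong : ∀ {A : Set} {P Q : A → Set} → (∀ x → P x ⇔ Q x) → (∀ x → P x) ⇔ (∀ x → Q x)
∀-cong P⇔Q = mk⇔ (λ p x → Equivalence.to (P⇔Q x) (p x)) (λ q x → Equivalence.from (P⇔Q x) (q x))

≤-cong : ∀ {a a′ b b′} → a ≡ a′ → b ≡ b′ → (a ≤ b) ⇔ (a′ ≤ b′)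
≤-cong a≡a′ b≡b′ = mk⇔ (subst₂ _≤_ a≡a′ b≡b′) (subst₂ _≤_ (sym a≡a′) (sym b≡b′))

∀-∸⇔∀ : ∀ {ℓ} {Q : ℕ → Set} → (∀ t → ℓ ≤ t → Q t) → (∀ j → Q (ℓ ∸ j)) ⇔ (∀ t → Q t)
∀-∸⇔∀ {ℓ} {Q} Q-beyond = mk⇔ to (λ q j → q (ℓ ∸ j))
  where
  to : (∀ j → Q (ℓ ∸ j)) → ∀ t → Q t
  to q t with t ≤? ℓ
  ... | yes t≤ℓ = subst Q (m∸[m∸n]≡n t≤ℓ) (q (ℓ ∸ t))
  ... | no  t≰ℓ = Q-beyond t (<⇒≤ (≰⇒> t≰ℓ))

Linked-cong : ∀ {A : Set} {R S : Rel A 0ℓ} → (∀ {x y} → R x y ⇔ S x y) →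
              ∀ {xs} → Linked R xs ⇔ Linked S xs
Linked-cong R⇔S = mk⇔ (Linked.map (Equivalence.to R⇔S)) (Linked.map (Equivalence.from R⇔S))

Linked-reverseAcc⁺ : ∀ {A : Set} {R : Rel A 0ℓ} {x xs acc} →
                     Linked (flip R) (x ∷ xs) → Linked R (x ∷ acc) → Linked R (reverseAcc (x ∷ acc) xs)
Linked-reverseAcc⁺ [-]      R-acc = R-acc
Linked-reverseAcc⁺ (r ∷ rs) R-acc = Linked-reverseAcc⁺ rs (r ∷ R-acc)

Linked-reverse⁺ : ∀ {A : Set} {R : Rel A 0ℓ} {xs} → Linked (flip R) xs → Linked R (reverse xs)
Linked-reverse⁺ {xs = []}    _  = []
Linked-reverse⁺ {xs = _ ∷ _} rs = Linked-reverseAcc⁺ rs [-]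

Linked-reverse⇔ : ∀ {A : Set} {R : Rel A 0ℓ} {xs} → Linked (flip R) xs ⇔ Linked R (reverse xs)
Linked-reverse⇔ {R = R} {xs} = mk⇔ Linked-reverse⁺
  (λ rs → subst (Linked (flip R)) (reverse-involutive xs) (Linked-reverse⁺ {R = flip R} rs))

valueAt : ∀ {A : Set} → (A → ℕ) → List A → ℕ → ℕ
valueAt f []       k       = 0
valueAt f (x ∷ xs) zero    = f x
valueAt f (x ∷ xs) (suc k) = valueAt f xs k

valueAt-zero : ∀ {A : Set} {f : A → ℕ} → (∀ x → f x ≡ 0) → ∀ xs k → valueAt f xs k ≡ 0
valueAt-zero f≡0 []       k       = refl
valueAt-zero f≡0 (x ∷ xs) zero    = f≡0 x
valueAt-zero f≡0 (x ∷ xs) (suc k) = valueAt-zero f≡0 xs k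

module _ {A I : Set} (f : I → A → ℕ) where

  Dominates : Rel A 0ℓ
  Dominates x y = ∀ i → f i y ≤ f i x

  Antitone : List A → Set
  Antitone xs = ∀ i k → valueAt (f i) xs (suc k) ≤ valueAt (f i) xs k

  linked⇒antitone : ∀ {xs} → Linked Dominates xs → Antitone xs
  linked⇒antitone []       i k       = z≤n
  linked⇒antitone [-]      i k       = z≤n
  linked⇒antitone (d ∷ ds) i zero    = d i
  linked⇒antitone (d ∷ ds) i (suc k) = linked⇒antitone ds i k

  antitone⇒linked : ∀ xs → Antitone xs → Linked Dominates xs
  antitone⇒linked []           _ = []
  antitone⇒linked (x ∷ [])     _ = [-]
  antitone⇒linked (x ∷ y ∷ xs) a = (λ i → a i zero) ∷ antitone⇒linked (y ∷ xs) (λ i k → a i (suc k))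

  linked⇔antitone : ∀ xs → Linked Dominates xs ⇔ Antitone xs
  linked⇔antitone xs = mk⇔ linked⇒antitone (antitone⇒linked xs)

module _ {A : Set} {P : Pred A 0ℓ} (P? : Decidable P) where

  countWith : List A → ℕ
  countWith xs = length (filter P? xs)

  countWith-++ : ∀ xs ys → countWith (xs ++ ys) ≡ countWith xs + countWith ys
  countWith-++ xs ys = trans (cong length (filter-++ P? xs ys)) (length-++ (filter P? xs))

  countWith-accept : ∀ {x} xs → P x → countWith (x ∷ xs) ≡ suc (countWith xs)
  countWith-accept _ Px = cong length (filter-accept P? Px)

  countWith-reject : ∀ {x} xs → ¬ P x → countWith (x ∷ xs) ≡ countWith xs
  countWith-reject _ ¬Px = cong length (filter-reject P? ¬Px)

  countWith-none : ∀ {xs} → All (∁ P) xs → countWith xs ≡ 0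
  countWith-none ¬Pxs = cong length (filter-none P? ¬Pxs)

  countWith-∷-cong : ∀ x xs ys → countWith xs ≡ countWith ys → countWith (x ∷ xs) ≡ countWith (x ∷ ys)
  countWith-∷-cong x _ _ eq with P? x
  ... | yes _ = cong suc eq
  ... | no  _ = eq

  countWith-∷-mono : ∀ {x y xs ys} → (P y → P x) → countWith ys ≤ countWith xs →
                     countWith (y ∷ ys) ≤ countWith (x ∷ xs)
  countWith-∷-mono {x} {y} Py⇒Px ys≤xs with P? y | P? x
  ... | yes _  | yes _  = s≤s ys≤xs
  ... | yes Py | no ¬Px = contradiction (Py⇒Px Py) ¬Px
  ... | no _   | yes _  = m≤n⇒m≤1+n ys≤xs
  ... | no _   | no _   = ys≤xs

  countWith-∷-cancel : ∀ {x y xs ys} → (P y → P x) → (¬ P y → countWith ys ≡ 0) →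
                       countWith (y ∷ ys) ≤ countWith (x ∷ xs) → countWith ys ≤ countWith xs
  countWith-∷-cancel {x} {y} Py⇒Px ys≡0 le with P? y | P? x | le
  ... | yes _  | yes _  | s≤s ys≤xs = ys≤xs
  ... | yes Py | no ¬Px | _         = contradiction (Py⇒Px Py) ¬Px
  ... | no ¬Py | _      | _         = subst (_≤ _) (sym (ys≡0 ¬Py)) z≤n

  countWith-reverse : ∀ xs → countWith (reverse xs) ≡ countWith xs
  countWith-reverse xs = ↭-length (filter-↭ P? (↭-reverse xs))

countWith-≐ : ∀ {A : Set} {P Q : Pred A 0ℓ} (P? : Decidable P) (Q? : Decidable Q) →
              (∀ {x} → P x ⇔ Q x) → ∀ xs → countWith P? xs ≡ countWith Q? xs
countWith-≐ P? Q? P⇔Q xs =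
  cong length (filter-≐ P? Q? (Equivalence.to P⇔Q , Equivalence.from P⇔Q) xs)

countWith-map : ∀ {A B : Set} {P : Pred A 0ℓ} (P? : Decidable P) (f : B → A) xs →
                countWith P? (map f xs) ≡ countWith (P? ∘ f) xs
countWith-map P? f []       = refl
countWith-map P? f (x ∷ xs) with P? (f x)
... | yes _ = cong suc (countWith-map P? f xs)
... | no  _ = countWith-map P? f xs

countBelow : ∀ {m} → ℕ → List (Fin m) → ℕ
countBelow t = countWith (λ x → toℕ x <? t)

countFrom : ∀ {m} → ℕ → List (Fin m) → ℕ
countFrom t = countWith (λ x → t ≤? toℕ x)

count-map-suc : ∀ {m} k (xs : List (Fin m)) → count (suc k) (map suc xs) ≡ count k xs
count-map-suc k xs = trans (countWith-map _ suc xs) (countWith-≐ _ _ (mk⇔ suc-injective (cong suc)) xs)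

count-map-suc-zero : ∀ {m} (xs : List (Fin m)) → count 0 (map suc xs) ≡ 0
count-map-suc-zero xs = countWith-none _ (All.map⁺ (universal (λ _ ()) xs))

count-none : ∀ {m} {k} {xs : List (Fin m)} → All (λ x → k < toℕ x) xs → count k xs ≡ 0
count-none k<xs = countWith-none _ (All.map (λ k<x x≡k → <-irrefl (sym x≡k) k<x) k<xs)

count-∷-cong : ∀ {m} k (x : Fin m) xs ys → count k xs ≡ count k ys → count k (x ∷ xs) ≡ count k (x ∷ ys)
count-∷-cong k = countWith-∷-cong (λ z → toℕ z ≟ k)

count-++ : ∀ {m} k (xs ys : List (Fin m)) → count k (xs ++ ys) ≡ count k xs + count k ys
count-++ k = countWith-++ (λ z → toℕ z ≟ k)

countBelow-map-suc : ∀ {m} t (xs : List (Fin m)) → countBelow (suc t) (map suc xs) ≡ countBelow t xs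
countBelow-map-suc t xs = trans (countWith-map _ suc xs) (countWith-≐ _ _ (mk⇔ s≤s⁻¹ s≤s) xs)

countFrom-map-suc : ∀ {m} t (xs : List (Fin m)) → countFrom (suc t) (map suc xs) ≡ countFrom t xs
countFrom-map-suc t xs = trans (countWith-map _ suc xs) (countWith-≐ _ _ (mk⇔ s≤s⁻¹ s≤s) xs)

countBelow-none : ∀ {m t} {xs : List (Fin m)} → All (λ x → t ≤ toℕ x) xs → countBelow t xs ≡ 0
countBelow-none t≤xs = countWith-none _ (All.map ≤⇒≯ t≤xs)

countFrom-none : ∀ {m t} {xs : List (Fin m)} → All (λ x → toℕ x < t) xs → countFrom t xs ≡ 0
countFrom-none xs<t = countWith-none _ (All.map <⇒≱ xs<t)

countFrom-zero : ∀ {m} (xs : List (Fin m)) → countFrom 0 xs ≡ length xs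
countFrom-zero xs = cong length (filter-all _ (universal (λ _ → z≤n) xs))

indicator : Bool → ℕ
indicator true  = 1
indicator false = 0

bits : ∀ {m} → Subset m → List ℕ
bits v = map indicator (toList v)

bit : ∀ {m} → Subset m → ℕ → ℕ
bit {zero}  v k       = 0
bit {suc m} v zero    = indicator (lookup v zero)
bit {suc m} v (suc k) = bit (tail v) k

prefixSum suffixSum : ∀ {m} → ℕ → Subset m → ℕ
prefixSum t v = sum (take t (bits v))
suffixSum t v = sum (drop t (bits v))

bits-tabulate : ∀ {m} (v : Subset m) → bits v ≡ tabulate (indicator ∘ lookup v)
bits-tabulate []      = refl
bits-tabulate (x ∷ v) = cong (indicator x ∷_) (bits-tabulate v)

suffixSum-beyond : ∀ {m} t (v : Subset m) → m ≤ t → suffixSum t v ≡ 0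
suffixSum-beyond t       []      _         = cong sum (drop-[] t)
suffixSum-beyond (suc t) (_ ∷ v) (s≤s m≤t) = suffixSum-beyond t v m≤t

entries-increasing : ∀ {m} (v : Subset m) → AllPairs Fin._<_ (entries v)
entries-increasing []          = []
entries-increasing (true ∷ v)  =
  All.map⁺ (universal (λ _ → s≤s z≤n) (entries v)) ∷ AllPairs.map⁺ (AllPairs.map s≤s (entries-increasing v))
entries-increasing (false ∷ v) = AllPairs.map⁺ (AllPairs.map s≤s (entries-increasing v))

count-entries : ∀ {m} k (v : Subset m) → count k (entries v) ≡ bit v k
count-entries k       []          = refl
count-entries zero    (true ∷ v)  = cong suc (count-map-suc-zero (entries v))
count-entries (suc k) (true ∷ v)  = trans (count-map-suc k (entries v)) (count-entries k v)
count-entries zero    (false ∷ v) = count-map-suc-zero (entries v)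
count-entries (suc k) (false ∷ v) = trans (count-map-suc k (entries v)) (count-entries k v)

length-entries : ∀ {m} (v : Subset m) → length (entries v) ≡ sum (bits v)
length-entries []          = refl
length-entries (true ∷ v)  = cong suc (trans (length-map suc (entries v)) (length-entries v))
length-entries (false ∷ v) = trans (length-map suc (entries v)) (length-entries v)

countBelow-entries : ∀ {m} t (v : Subset m) → countBelow t (entries v) ≡ prefixSum t v
countBelow-entries zero    v           = countBelow-none (universal (λ _ → z≤n) (entries v))
countBelow-entries (suc t) []          = refl
countBelow-entries (suc t) (true ∷ v)  =
  cong suc (trans (countBelow-map-suc t (entries v)) (countBelow-entries t v))
countBelow-entries (suc t) (false ∷ v) = trans (countBelow-map-suc t (entries v)) (countBelow-entries t v)

countFrom-entries : ∀ {m} t (v : Subset m) → countFrom t (entries v) ≡ suffixSum t v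
countFrom-entries zero    v           = trans (countFrom-zero (entries v)) (length-entries v)
countFrom-entries (suc t) []          = refl
countFrom-entries (suc t) (true ∷ v)  = trans (countFrom-map-suc t (entries v)) (countFrom-entries t v)
countFrom-entries (suc t) (false ∷ v) = trans (countFrom-map-suc t (entries v)) (countFrom-entries t v)

rowLe⇒countBelow : ∀ {m} {xs ys : List (Fin m)} → length ys ≤ length xs → RowLe xs ys →
                   ∀ t → countBelow t ys ≤ countBelow t xs
rowLe⇒countBelow {ys = []}    _  []ˡ t = z≤n
rowLe⇒countBelow {ys = _ ∷ _} () []ˡ
rowLe⇒countBelow              _  []ʳ t = z≤n
rowLe⇒countBelow (s≤s ∣ys∣≤∣xs∣) (x≤y ∷ row) t =
  countWith-∷-mono (λ z → toℕ z <? t) (≤-<-trans x≤y) (rowLe⇒countBelow ∣ys∣≤∣xs∣ row t)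

countBelow⇒rowLe : ∀ {m} {xs ys : List (Fin m)} → AllPairs Fin._<_ xs → AllPairs Fin._<_ ys →
                   (∀ t → countBelow t ys ≤ countBelow t xs) → length ys ≤ length xs × RowLe xs ys
countBelow⇒rowLe {xs = []}    {[]}    _ _ _ = z≤n , []ˡ
countBelow⇒rowLe {xs = _ ∷ _} {[]}    _ _ _ = z≤n , []ʳ
countBelow⇒rowLe {xs = []}    {y ∷ ys} _ _ below
  with () ← subst (_≤ 0) (countWith-accept (λ z → toℕ z <? suc (toℕ y)) ys ≤-refl) (below (suc (toℕ y)))
countBelow⇒rowLe {xs = x ∷ xs} {y ∷ ys} (x<xs ∷ xs↑) (y<ys ∷ ys↑) below =
  s≤s (proj₁ rest) , x≤y ∷ proj₂ rest
  where
  x≤y : x Fin.≤ y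
  x≤y = ≮⇒≥ λ y<x → contradiction
    (subst₂ _≤_ (countWith-accept (λ z → toℕ z <? suc (toℕ y)) ys ≤-refl)
                (countBelow-none (y<x ∷ All.map (λ x<z → ≤-trans y<x (<⇒≤ x<z)) x<xs))
                (below (suc (toℕ y))))
    λ ()
  rest = countBelow⇒rowLe xs↑ ys↑ λ t → countWith-∷-cancel (λ z → toℕ z <? t) (≤-<-trans x≤y)
    (λ y≮t → countBelow-none (All.map (λ y<z → ≤-trans (≮⇒≥ y≮t) (<⇒≤ y<z)) y<ys))
    (below t)

rowLe⇒countFrom : ∀ {m} {xs ys : List (Fin m)} → length xs ≤ length ys → RowLe xs ys →
                  ∀ t → countFrom t xs ≤ countFrom t ys
rowLe⇒countFrom _  []ˡ t = z≤n
rowLe⇒countFrom () []ʳ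
rowLe⇒countFrom (s≤s ∣xs∣≤∣ys∣) (x≤y ∷ row) t =
  countWith-∷-mono (λ z → t ≤? toℕ z) (λ t≤x → ≤-trans t≤x x≤y) (rowLe⇒countFrom ∣xs∣≤∣ys∣ row t)

countFrom⇒rowLe : ∀ {m} {xs ys : List (Fin m)} →
                  AllPairs (flip Fin._<_) xs → AllPairs (flip Fin._<_) ys →
                  (∀ t → countFrom t xs ≤ countFrom t ys) → length xs ≤ length ys × RowLe xs ys
countFrom⇒rowLe {xs = []}    _ _ _ = z≤n , []ˡ
countFrom⇒rowLe {xs = x ∷ xs} {[]} _ _ from
  with () ← subst (_≤ 0) (countWith-accept (λ z → toℕ x ≤? toℕ z) xs ≤-refl) (from (toℕ x))
countFrom⇒rowLe {xs = x ∷ xs} {y ∷ ys} (x>xs ∷ xs↓) (y>ys ∷ ys↓) from =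
  s≤s (proj₁ rest) , x≤y ∷ proj₂ rest
  where
  x≤y : x Fin.≤ y
  x≤y = ≮⇒≥ λ y<x → contradiction
    (subst₂ _≤_ (countWith-accept (λ z → toℕ x ≤? toℕ z) xs ≤-refl)
                (countFrom-none (y<x ∷ All.map (λ z<y → <-trans z<y y<x) y>ys))
                (from (toℕ x)))
    λ ()
  rest = countFrom⇒rowLe xs↓ ys↓ λ t → countWith-∷-cancel (λ z → t ≤? toℕ z) (λ t≤x → ≤-trans t≤x x≤y)
    (λ t≰x → countFrom-none (All.map (λ z<x → <-trans z<x (≰⇒> t≰x)) x>xs))
    (from t)

reverse-increasing : ∀ {m} {xs : List (Fin m)} → AllPairs Fin._<_ xs → AllPairs (flip Fin._<_) (reverse xs)
reverse-increasing = Linked⇒AllPairs (flip Fin.<-trans) ∘ Linked-reverse⁺ ∘ AllPairs⇒Linked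

topAdj⇔prefixSums : ∀ {m} (x y : Subset m) → TopAdj x y ⇔ (∀ t → prefixSum t y ≤ prefixSum t x)
topAdj⇔prefixSums x y = begin
  TopAdj x y
    ≈⟨ mk⇔ (uncurry rowLe⇒countBelow) (countBelow⇒rowLe (entries-increasing x) (entries-increasing y)) ⟩
  (∀ t → countBelow t (entries y) ≤ countBelow t (entries x))
    ≈⟨ ∀-cong (λ t → ≤-cong (countBelow-entries t y) (countBelow-entries t x)) ⟩
  (∀ t → prefixSum t y ≤ prefixSum t x) ∎
  where open import Relation.Binary.Reasoning.Setoid (⇔.⇔-setoid 0ℓ)

botAdj⇔suffixSums : ∀ {m} (x y : Subset m) → BotAdj x y ⇔ (∀ t → suffixSum t x ≤ suffixSum t y)
botAdj⇔suffixSums x y = begin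
  BotAdj x y
    ≈⟨ ≤-cong (sym (length-reverse (entries x))) (sym (length-reverse (entries y))) ×-⇔ ⇔.refl ⟩
  (length (reverse (entries x)) ≤ length (reverse (entries y)) × RowLe (reverse (entries x)) (reverse (entries y)))
    ≈⟨ mk⇔ (uncurry rowLe⇒countFrom)
           (countFrom⇒rowLe (reverse-increasing (entries-increasing x)) (reverse-increasing (entries-increasing y))) ⟩
  (∀ t → countFrom t (reverse (entries x)) ≤ countFrom t (reverse (entries y)))
    ≈⟨ ∀-cong (λ t → ≤-cong (countFrom-reverse-entries t x) (countFrom-reverse-entries t y)) ⟩
  (∀ t → suffixSum t x ≤ suffixSum t y) ∎
  where
  open import Relation.Binary.Reasoning.Setoid (⇔.⇔-setoid 0ℓ)
  countFrom-reverse-entries : ∀ t v → countFrom t (reverse (entries v)) ≡ suffixSum t v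
  countFrom-reverse-entries t v = trans (countWith-reverse _ (entries v)) (countFrom-entries t v)

Transposed : ∀ {n ℓ} → (Fin n → Subset ℓ) → (Fin ℓ → Subset n) → Set
Transposed e b = ∀ i j → lookup (e i) j ≡ lookup (b j) i

dual-transposed : ∀ {n ℓ} (b : Fin ℓ → Subset n) → Transposed (dual b) b
dual-transposed b i = lookup∘tabulate (λ j → lookup (b j) i)

transposed-dual : ∀ {n ℓ} (b : Fin ℓ → Subset n) → Transposed b (dual b)
transposed-dual b j i = sym (dual-transposed b i j)

lookup-tail : ∀ {A : Set} {m} (v : Vec A (suc m)) j → lookup (tail v) j ≡ lookup v (suc j)
lookup-tail (_ ∷ _) j = refl

-- The k-th bits of the columns of e form the k-th column of b; beyond the last column of b
-- they are all 0, which is what the hypothesis on F is for.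
transposed-bits : (F : List ℕ → ℕ) → (∀ {xs} → All (_≡ 0) xs → F xs ≡ 0) →
                  ∀ {n ℓ} {e : Fin n → Subset ℓ} {b : Fin ℓ → Subset n} → Transposed e b →
                  ∀ k → F (tabulate (λ i → bit (e i) k)) ≡ valueAt (F ∘ bits) (tabulate b) k
transposed-bits F F-zeros {ℓ = zero}          _   k       = F-zeros (All.tabulate⁺ (λ _ → refl))
transposed-bits F F-zeros {ℓ = suc ℓ} {e} {b} e⊤b zero    = begin
  F (tabulate (λ i → indicator (lookup (e i) zero))) ≡⟨ cong F (tabulate-cong (cong indicator ∘ flip e⊤b zero)) ⟩
  F (tabulate (indicator ∘ lookup (b zero)))         ≡⟨ cong F (bits-tabulate (b zero)) ⟨
  F (bits (b zero))                                  ∎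
  where open ≡-Reasoning
transposed-bits F F-zeros {ℓ = suc ℓ} {e} {b} e⊤b (suc k) =
  transposed-bits F F-zeros {e = tail ∘ e} {b ∘ suc} (λ i j → trans (lookup-tail (e i) j) (e⊤b i (suc j))) k

count-concat-entries : ∀ {m} k (vs : List (Subset m)) →
                       count k (concat (map entries vs)) ≡ sum (map (λ v → bit v k) vs)
count-concat-entries k []       = refl
count-concat-entries k (v ∷ vs) = trans (count-++ k (entries v) (concat (map entries vs)))
                                        (cong₂ _+_ (count-entries k v) (count-concat-entries k vs))

count-blocks : ∀ {m} j k (vs : List (Subset m)) →
               count k (concat (take j (map entries vs))) ≡ sum (take j (map (λ v → bit v k) vs))
count-blocks j k vs = begin
  count k (concat (take j (map entries vs)))  ≡⟨ cong (count k ∘ concat) (take-map j vs) ⟩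
  count k (concat (map entries (take j vs)))  ≡⟨ count-concat-entries k (take j vs) ⟩
  sum (map (λ v → bit v k) (take j vs))       ≡⟨ cong sum (take-map j vs) ⟨
  sum (take j (map (λ v → bit v k) vs))       ∎
  where open ≡-Reasoning

count-dualBlocks : ∀ {n ℓ} (b : Fin ℓ → Subset n) j k →
                   count k (concat (take j (map entries (tabulate (dual b))))) ≡ valueAt (prefixSum j) (tabulate b) k
count-dualBlocks b j k = begin
  count k (concat (take j (map entries (tabulate (dual b)))))  ≡⟨ count-blocks j k (tabulate (dual b)) ⟩
  sum (take j (map (λ v → bit v k) (tabulate (dual b))))       ≡⟨ cong (sum ∘ take j) (map-tabulate (dual b) _) ⟩
  sum (take j (tabulate (λ i → bit (dual b i) k)))             ≡⟨ transposed-bits (sum ∘ take j) (sum-zero ∘ All.take⁺ j)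
                                                                             (dual-transposed b) k ⟩
  valueAt (prefixSum j) (tabulate b) k                         ∎
  where open ≡-Reasoning

count-reversedBlocks : ∀ {n ℓ} (b : Fin ℓ → Subset n) j k →
                       count k (concat (take j (map entries (reverse (tabulate b)))))
                         ≡ valueAt (suffixSum (ℓ ∸ j)) (tabulate (dual b)) k
count-reversedBlocks {ℓ = ℓ} b j k = begin
  count k (concat (take j (map entries (reverse (tabulate b)))))  ≡⟨ count-blocks j k (reverse (tabulate b)) ⟩
  sum (take j (map bitₖ (reverse (tabulate b))))                  ≡⟨ cong (sum ∘ take j) (reverse-map bitₖ (tabulate b)) ⟩
  sum (take j (reverse (map bitₖ (tabulate b))))                  ≡⟨ sum-take-reverse j (map bitₖ (tabulate b)) ⟩
  sum (drop (length (map bitₖ (tabulate b)) ∸ j) (map bitₖ (tabulate b)))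
    ≡⟨ cong (λ d → sum (drop (d ∸ j) (map bitₖ (tabulate b)))) (trans (length-map bitₖ (tabulate b)) (length-tabulate b)) ⟩
  sum (drop (ℓ ∸ j) (map bitₖ (tabulate b)))                      ≡⟨ cong (sum ∘ drop (ℓ ∸ j)) (map-tabulate b bitₖ) ⟩
  sum (drop (ℓ ∸ j) (tabulate (λ i → bit (b i) k)))               ≡⟨ transposed-bits (sum ∘ drop (ℓ ∸ j)) (sum-zero ∘ All.drop⁺ (ℓ ∸ j))
                                                                                (transposed-dual b) k ⟩
  valueAt (suffixSum (ℓ ∸ j)) (tabulate (dual b)) k               ∎
  where
  open ≡-Reasoning
  bitₖ : ∀ {m} → Subset m → ℕ
  bitₖ v = bit v k

Ballot : ∀ {m} → ℕ → List (Fin m) → Set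
Ballot k w = count (suc k) w ≤ count k w

BallotBlocks : ∀ {m} → List (List (Fin m)) → Set
BallotBlocks bs = ∀ j k → Ballot k (concat (take j bs))

-- An increasing word meets k+1 only after k, so a prefix has no k+1 or already all of the k and k+1.
increasing-prefix-counts : ∀ {m} {B : List (Fin m)} → AllPairs Fin._<_ B → ∀ i k →
  count (suc k) (take i B) ≡ 0 ⊎
  (count (suc k) (take i B) ≡ count (suc k) B × count k (take i B) ≡ count k B)
increasing-prefix-counts {B = []}    _ i k = inj₁ (cong (count (suc k)) (take-[] i))
increasing-prefix-counts {B = _ ∷ _} _ zero k = inj₁ refl
increasing-prefix-counts {B = x ∷ B} (x<B ∷ B↑) (suc i) k
  with increasing-prefix-counts B↑ i k | toℕ x ≟ suc k
... | inj₂ (same₁ , same₀) | _ =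
  inj₂ (count-∷-cong (suc k) x _ _ same₁ , count-∷-cong k x _ _ same₀)
... | inj₁ none₁ | no x≢1+k = inj₁ (trans (countWith-reject (λ z → toℕ z ≟ suc k) (take i B) x≢1+k) none₁)
... | inj₁ none₁ | yes x≡1+k = inj₂ (count-∷-cong (suc k) x _ _ (trans none₁ (sym (count-none 1+k<B))) ,
                                     count-∷-cong k x _ _ (trans (count-none (All.take⁺ i k<B)) (sym (count-none k<B))))
  where
  1+k<B : All (λ z → suc k < toℕ z) B
  1+k<B = All.map (subst (_< _) x≡1+k) x<B
  k<B : All (λ z → k < toℕ z) B
  k<B = All.map (≤-trans (n≤1+n (suc k))) 1+k<B

ballot-within-block : ∀ {m} (p : List (Fin m)) {B} → AllPairs Fin._<_ B → ∀ k →
                      Ballot k p → Ballot k (p ++ B) → ∀ i → Ballot k (p ++ take i B)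
ballot-within-block p {B} B↑ k ballot-p ballot-pB i with increasing-prefix-counts B↑ i k
... | inj₁ none₁ = begin
  count (suc k) (p ++ take i B)               ≡⟨ count-++ (suc k) p (take i B) ⟩
  count (suc k) p + count (suc k) (take i B)  ≡⟨ cong (count (suc k) p +_) none₁ ⟩
  count (suc k) p + 0                         ≡⟨ +-identityʳ _ ⟩
  count (suc k) p                             ≤⟨ ballot-p ⟩
  count k p                                   ≤⟨ m≤m+n _ _ ⟩
  count k p + count k (take i B)              ≡⟨ count-++ k p (take i B) ⟨
  count k (p ++ take i B)                     ∎
  where open ≤-Reasoning
... | inj₂ (same₁ , same₀) = subst₂ _≤_ (count-p++-cong (suc k) same₁) (count-p++-cong k same₀) ballot-pB
  where
  count-p++-cong : ∀ k′ → count k′ (take i B) ≡ count k′ B → count k′ (p ++ B) ≡ count k′ (p ++ take i B)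
  count-p++-cong k′ same = begin
    count k′ (p ++ B)                 ≡⟨ count-++ k′ p B ⟩
    count k′ p + count k′ B           ≡⟨ cong (count k′ p +_) same ⟨
    count k′ p + count k′ (take i B)  ≡⟨ count-++ k′ p (take i B) ⟨
    count k′ (p ++ take i B)          ∎
    where open ≡-Reasoning

ballotBlocks⇒yamanouchi : ∀ {m} (p : List (Fin m)) bs → All (AllPairs Fin._<_) bs →
                          (∀ j k → Ballot k (p ++ concat (take j bs))) →
                          ∀ i k → Ballot k (p ++ take i (concat bs))
ballotBlocks⇒yamanouchi p [] [] ballot i k =
  subst (λ w → Ballot k (p ++ w)) (sym (take-[] i)) (ballot 0 k)
ballotBlocks⇒yamanouchi p (B ∷ bs) (B↑ ∷ bs↑) ballot i k with length B ≤? i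
... | yes ∣B∣≤i = subst (Ballot k) (sym split)
  (ballotBlocks⇒yamanouchi (p ++ B) bs bs↑ (λ j k → subst (Ballot k) (sym (++-assoc p B _)) (ballot (suc j) k))
                           (i ∸ length B) k)
  where
  split : p ++ take i (B ++ concat bs) ≡ (p ++ B) ++ take (i ∸ length B) (concat bs)
  split = trans (cong (p ++_) (take-++ʳ B (concat bs) ∣B∣≤i)) (sym (++-assoc p B _))
... | no ∣B∣≰i = subst (λ w → Ballot k (p ++ w)) (sym (take-++ˡ B (concat bs) (<⇒≤ (≰⇒> ∣B∣≰i))))
  (ballot-within-block p B↑ k (subst (Ballot k) (++-identityʳ p) (ballot 0 k))
                           (subst (λ w → Ballot k (p ++ w)) (++-identityʳ B) (ballot 1 k)) i)

yamanouchi⇒ballotBlocks : ∀ {m} (bs : List (List (Fin m))) → YamanouchiWord (concat bs) → BallotBlocks bs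
yamanouchi⇒ballotBlocks bs yam j k = subst (Ballot k) prefix (yam (length (concat (take j bs))) k)
  where
  open ≡-Reasoning
  w = concat (take j bs)
  prefix : take (length w) (concat bs) ≡ w
  prefix = begin
    take (length w) (concat bs)                        ≡⟨ cong (take (length w) ∘ concat) (take++drop≡id j bs) ⟨
    take (length w) (concat (take j bs ++ drop j bs))  ≡⟨ cong (take (length w)) (concat-++ (take j bs) (drop j bs)) ⟨
    take (length w) (w ++ concat (drop j bs))          ≡⟨ take-length-++ w (concat (drop j bs)) ⟩
    w                                                  ∎

yamanouchi⇔ballotBlocks : ∀ {m} {bs : List (List (Fin m))} → All (AllPairs Fin._<_) bs →
                          YamanouchiWord (concat bs) ⇔ BallotBlocks bs
yamanouchi⇔ballotBlocks {bs = bs} bs↑ = mk⇔ (yamanouchi⇒ballotBlocks bs) (ballotBlocks⇒yamanouchi [] bs bs↑)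

entries-all-increasing : ∀ {m} (vs : List (Subset m)) → All (AllPairs Fin._<_) (map entries vs)
entries-all-increasing vs = All.map⁺ (universal entries-increasing vs)

tableau⇔dualYamanouchi : ∀ {n ℓ} (b : Fin ℓ → Subset n) → TableauF b ⇔ YamanouchiḞ (dual b)
tableau⇔dualYamanouchi b = begin
  TableauF b                                    ≈⟨ Linked-cong (topAdj⇔prefixSums _ _) ⟩
  Linked (Dominates prefixSum) (tabulate b)     ≈⟨ linked⇔antitone prefixSum (tabulate b) ⟩
  Antitone prefixSum (tabulate b)               ≈⟨ ∀-cong (λ j → ∀-cong (λ k →
                                                     ≤-cong (sym (count-dualBlocks b j (suc k))) (sym (count-dualBlocks b j k)))) ⟩
  BallotBlocks (map entries (tabulate (dual b))) ≈⟨ yamanouchi⇔ballotBlocks (entries-all-increasing (tabulate (dual b))) ⟨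
  YamanouchiḞ (dual b)                          ∎
  where open import Relation.Binary.Reasoning.Setoid (⇔.⇔-setoid 0ℓ)

yamanouchi⇔dualAntitableau : ∀ {n ℓ} (b : Fin ℓ → Subset n) → YamanouchiF b ⇔ AntitableauḞ (dual b)
yamanouchi⇔dualAntitableau {ℓ = ℓ} b = begin
  YamanouchiF b
    ≈⟨ yamanouchi⇔ballotBlocks (entries-all-increasing (reverse (tabulate b))) ⟩
  BallotBlocks (map entries (reverse (tabulate b)))
    ≈⟨ ∀-cong (λ j → ∀-cong (λ k → ≤-cong (count-reversedBlocks b j (suc k)) (count-reversedBlocks b j k))) ⟩
  (∀ j → Q (ℓ ∸ j))                             ≈⟨ ∀-∸⇔∀ Q-beyond ⟩
  Antitone suffixSum L                          ≈⟨ linked⇔antitone suffixSum L ⟨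
  Linked (Dominates suffixSum) L                ≈⟨ Linked-cong (botAdj⇔suffixSums _ _) ⟨
  Linked (flip BotAdj) L                        ≈⟨ Linked-reverse⇔ ⟩
  AntitableauḞ (dual b)                         ∎
  where
  open import Relation.Binary.Reasoning.Setoid (⇔.⇔-setoid 0ℓ)
  L = tabulate (dual b)
  Q : ℕ → Set
  Q t = ∀ k → valueAt (suffixSum t) L (suc k) ≤ valueAt (suffixSum t) L k
  Q-beyond : ∀ t → ℓ ≤ t → Q t
  Q-beyond t ℓ≤t k = subst (_≤ valueAt (suffixSum t) L k)
                           (sym (valueAt-zero (λ v → suffixSum-beyond t v ℓ≤t) L (suc k))) z≤n

proposition2p17 : (n ℓ : ℕ) → 2 ≤ n → 2 ≤ ℓ → (s : ℕ)
    → (b : Fin ℓ → Subset n) → size b ≡ s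
    → (TableauF b ⇔ YamanouchiḞ (dual b)) × (YamanouchiF b ⇔ AntitableauḞ (dual b))
proposition2p17 n ℓ _ _ s b _ = tableau⇔dualYamanouchi b , yamanouchi⇔dualAntitableau b
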